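{- Let $(G,c,k)$ be an instance of \textsc{Multi-STC} and let $A\subseteq\mathscr{P}$ be a periphery component such that there exists an edge $\{u,v\}\in E(A)$ which is part of a triangle $G[\{u,v,w\}]$ in $G$. Then $A$ is good.
   Context: A $c$-colored labeling of $G=(V,E)$ is a partition $L=(S^1_L,\dots,S^c_L,W_L)$ of $E$; it is an STC-labeling if there are no $\{u,v\},\{v,w\}\in S^i_L$ ($u\ne w$) with $\{u,w\}\notin E$. Fix $D\subseteq E$ such that $(V,E\setminus D)$ has maximum degree at most $\lfloor c/2\rfloor+1$; the core $\mathscr{C}$ is the set of vertices incident with an edge of $D$, $\mathscr{P}=V\setminus\mathscr{C}$, and a periphery component is the vertex set of a connected component of $G[\mathscr{P}]$. $E(A)$ denotes edges with both endpoints in $A$. Labelings $L,L'$ are partially equal on $E'$ if for all $e\in E'$ and all $i$, $e\in S^i_L\iff e\in S^i_{L'}$. A periphery component $A$ is good if for every STC-labeling $L$ of $G$ with $E(A)\subseteq W_L$ there is an STC-labeling $L'$ partially equal to $L$ on $E\setminus E(A)$ with $W_{L'}\cap E(A)=\emptyset$. -}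

module Defs where

open import Data.Nat using (ℕ; _≤_; _/_; suc)
open import Data.Fin using (Fin)
open import Data.Bool using (Bool; true; false; _∧_; not)
open import Data.Maybe using (Maybe; just; nothing)
open import Data.List using (length; filterᵇ)
open import Data.List using () renaming (List to L)
open import Data.Fin.Base using ()
open import Data.List.Base using ()
open import Data.Product using (Σ; _×_; ∃; ∃-syntax)
open import Relation.Binary.PropositionalEquality using (_≡_; _≢_)
open import Relation.Nullary using (¬_)
open import Function.Bundles using (_⇔_)
import Data.List.Base as List
import Data.Fin as Fin

record Graph (n : ℕ) : Set where
  field
    adj    : Fin n → Fin n → Bool
    sym    : ∀ u v → adj u v ≡ adj v u
    irrefl : ∀ v → adj v v ≡ false
open Graph public

Edge : ∀ {n} → Graph n → Fin n → Fin n → Set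
Edge G u v = adj G u v ≡ true

-- Labels of a c-colored labeling: just i = strong in color i (S^{i+1}), nothing = weak (W).
Label : ℕ → Set
Label c = Maybe (Fin c)

-- A c-colored labeling of G = a partition of E into S^1..S^c, W,
-- represented as a label for each edge, independent of orientation.
record Labeling {n} (G : Graph n) (c : ℕ) : Set where
  field
    lab    : Fin n → Fin n → Label c
    labSym : ∀ u v → Edge G u v → lab u v ≡ lab v u
open Labeling public

IsSTC : ∀ {n} {G : Graph n} {c} → Labeling G c → Set
IsSTC {n} {G} {c} L = ∀ (u v w : Fin n) (i : Fin c) → u ≢ w →
  Edge G u v → Edge G v w → lab L u v ≡ just i → lab L v w ≡ just i → Edge G u w

degMinus : ∀ {n} → Graph n → (Fin n → Fin n → Bool) → Fin n → ℕ
degMinus {n} G D v = length (filterᵇ (λ w → adj G v w ∧ not (D v w)) (List.allFin n))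

record DeletionSet {n} (G : Graph n) (c : ℕ) : Set where
  field
    D      : Fin n → Fin n → Bool
    Dsym   : ∀ u v → D u v ≡ D v u
    D⊆E    : ∀ u v → D u v ≡ true → Edge G u v
    degree : ∀ v → degMinus G D v ≤ suc (c / 2)
open DeletionSet public

InCore : ∀ {n} {G : Graph n} {c} → DeletionSet G c → Fin n → Set
InCore {n} Δ v = ∃[ w ] D Δ v w ≡ true

InPeriphery : ∀ {n} {G : Graph n} {c} → DeletionSet G c → Fin n → Set
InPeriphery Δ v = ¬ InCore Δ v

data ReachIn {n} (G : Graph n) (S : Fin n → Set) (x : Fin n) : Fin n → Set where
  here : S x → ReachIn G S x x
  step : ∀ {v w} → ReachIn G S x v → S w → Edge G v w → ReachIn G S x w

IsPeripheryComponent : ∀ {n} {G : Graph n} {c} → DeletionSet G c → (Fin n → Bool) → Set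
IsPeripheryComponent {n} {G} Δ A =
  ∃[ x ] (InPeriphery Δ x × (∀ y → (A y ≡ true) ⇔ ReachIn G (InPeriphery Δ) x y))

InEA : ∀ {n} (G : Graph n) → (Fin n → Bool) → Fin n → Fin n → Set
InEA G A u v = Edge G u v × A u ≡ true × A v ≡ true

PartiallyEqualOutside : ∀ {n} {G : Graph n} {c} → (Fin n → Bool) → Labeling G c → Labeling G c → Set
PartiallyEqualOutside {n} {G} A L L' =
  ∀ u v → Edge G u v → ¬ InEA G A u v → lab L u v ≡ lab L' u v

IsGood : ∀ {n} (G : Graph n) (c : ℕ) → (Fin n → Bool) → Set
IsGood {n} G c A =
  ∀ (L : Labeling G c) → IsSTC L →
  (∀ u v → InEA G A u v → lab L u v ≡ nothing) →
  Σ (Labeling G c) λ L' → IsSTC L' × PartiallyEqualOutside A L L' ×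
    (∀ u v → InEA G A u v → lab L' u v ≢ nothing)

module Submission where

-- Every vertex of A is in the periphery, so it has degree at most ⌊c/2⌋+1 in G.  An edge
-- {x,y} can then be made strong in a fresh colour without violating STC as soon as one of its
-- ends has a second neighbour that cannot produce a conflict — a common neighbour of x and y, or
-- a weak edge: the conflicting colours at x and y number at most (deg x - 2) + (deg y - 1) < c
-- (EdgeColouring).  Order the edges of E(A) by the sum of the breadth-first depths of their ends
-- around {u,v} inside A (Layers, using that A is connected).  Every edge other than {u,v} has an
-- adjacent edge of E(A) of smaller key, and {u,v} lies in the triangle uvw.  Hence colouring E(A)
-- in phases of decreasing key, while all smaller keys are still weak, always succeeds
-- (TriangleComponent.FromLabeling), and nothing outside E(A) is touched.

open import Defs
open import Data.Nat using (ℕ; zero; suc; _+_; _*_; _≤_; _<_; z≤n; s≤s; _/_)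
open import Data.Nat.Properties
open import Data.Nat.DivMod using (m/n*n≤m)
open import Data.Fin using (Fin; zero; suc)
import Data.Fin as F
import Data.Fin.Properties as FP
open import Data.Bool using (Bool; true; false; _∧_; _∨_; not; if_then_else_)
import Data.Bool as B
open import Data.Bool.Properties using (∧-identityʳ)
open import Data.Maybe using (Maybe; just; nothing; is-just)
open import Data.List using (List; []; _∷_; length; _++_; lookup; filterᵇ; tabulate; catMaybes; allFin; cartesianProduct)
open import Data.List.Properties using (length-++)
open import Data.List.Relation.Unary.Any using (here; there; index; any?)
open import Data.List.Relation.Unary.Any.Properties using (lookup-index)
open import Data.List.Membership.Propositional using (_∈_; _∉_)
open import Data.List.Membership.Propositional.Properties using (∈-++⁺ˡ; ∈-++⁺ʳ; ∈-cartesianProduct⁺; ∈-allFin)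
open import Data.Product using (Σ; _×_; _,_; ∃; ∃-syntax; proj₁; proj₂)
open import Data.Sum using (_⊎_; inj₁; inj₂)
open import Data.Empty using (⊥; ⊥-elim)
open import Relation.Nullary using (¬_; Dec; yes; no)
open import Relation.Nullary.Decidable using (⌊_⌋; _×-dec_; _⊎-dec_)
open import Relation.Binary.PropositionalEquality renaming (sym to ≡-sym)
open import Function using (_∘_)
open import Function.Bundles using (_⇔_; Equivalence)

ind : Bool → ℕ
ind b = if b then 1 else 0

count : ∀ {n} → (Fin n → Bool) → ℕ
count {zero} f = 0
count {suc n} f = ind (f zero) + count (f ∘ suc)

_⇒ᵇ_ : ∀ {n} → (Fin n → Bool) → (Fin n → Bool) → Set
f ⇒ᵇ g = ∀ z → f z ≡ true → g z ≡ true

ind-mono : ∀ a b → (a ≡ true → b ≡ true) → ind a ≤ ind b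
ind-mono false b _ = z≤n
ind-mono true b a⇒b rewrite a⇒b refl = ≤-refl

count-cong : ∀ {n} (f g : Fin n → Bool) → (∀ z → f z ≡ g z) → count f ≡ count g
count-cong {zero} f g e = refl
count-cong {suc n} f g e = cong₂ _+_ (cong ind (e zero)) (count-cong (f ∘ suc) (g ∘ suc) (e ∘ suc))

count-mono : ∀ {n} (f g : Fin n → Bool) → f ⇒ᵇ g → count f ≤ count g
count-mono {zero} f g f⇒g = z≤n
count-mono {suc n} f g f⇒g =
  +-mono-≤ (ind-mono (f zero) (g zero) (f⇒g zero)) (count-mono (f ∘ suc) (g ∘ suc) (f⇒g ∘ suc))

count-mono-strict : ∀ {n} (f g : Fin n → Bool) → f ⇒ᵇ g → (a : Fin n) → f a ≡ false → g a ≡ true →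
  suc (count f) ≤ count g
count-mono-strict f g f⇒g zero fa ga rewrite fa | ga = s≤s (count-mono (f ∘ suc) (g ∘ suc) (f⇒g ∘ suc))
count-mono-strict f g f⇒g (suc a) fa ga = begin
  suc (count f)                       ≡⟨ ≡-sym (+-suc (ind (f zero)) _) ⟩
  ind (f zero) + suc (count (f ∘ suc)) ≤⟨ +-mono-≤ (ind-mono (f zero) (g zero) (f⇒g zero))
                                          (count-mono-strict (f ∘ suc) (g ∘ suc) (f⇒g ∘ suc) a fa ga) ⟩
  count g                             ∎
  where open ≤-Reasoning

-- Two distinct such points make it count by two: pass through f extended by the first point.
count-mono-strict₂ : ∀ {n} (f g : Fin n → Bool) → f ⇒ᵇ g → (a b : Fin n) → a ≢ b →
  f a ≡ false → g a ≡ true → f b ≡ false → g b ≡ true → suc (suc (count f)) ≤ count g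
count-mono-strict₂ {n} f g f⇒g a b a≢b fa ga fb gb =
  ≤-trans (s≤s (count-mono-strict f f+a f⇒f+a a fa f+a-a)) (count-mono-strict f+a g f+a⇒g b f+a-b gb)
  where
  f+a : Fin n → Bool
  f+a z = f z ∨ ⌊ z F.≟ a ⌋
  f⇒f+a : f ⇒ᵇ f+a
  f⇒f+a z e rewrite e = refl
  f+a⇒g : f+a ⇒ᵇ g
  f+a⇒g z e with f z in fz | z F.≟ a
  ... | true  | _       = f⇒g z fz
  ... | false | yes refl = ga
  f+a-a : f+a a ≡ true
  f+a-a rewrite fa with a F.≟ a
  ... | yes _ = refl
  ... | no a≢a = ⊥-elim (a≢a refl)
  f+a-b : f+a b ≡ false
  f+a-b rewrite fb with b F.≟ a
  ... | yes b≡a = ⊥-elim (a≢b (≡-sym b≡a))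
  ... | no _ = refl

length-filter-tabulate : ∀ {A : Set} {n} (p : A → Bool) (f : Fin n → A) →
  length (filterᵇ p (tabulate f)) ≡ count (p ∘ f)
length-filter-tabulate {n = zero} p f = refl
length-filter-tabulate {n = suc n} p f with p (f zero)
... | true  = cong suc (length-filter-tabulate p (f ∘ suc))
... | false = length-filter-tabulate p (f ∘ suc)

length-catMaybes-tabulate : ∀ {n} {A : Set} (h : Fin n → Maybe A) →
  length (catMaybes (tabulate h)) ≡ count (is-just ∘ h)
length-catMaybes-tabulate {zero} h = refl
length-catMaybes-tabulate {suc n} h with h zero
... | just _  = cong suc (length-catMaybes-tabulate (h ∘ suc))
... | nothing = length-catMaybes-tabulate (h ∘ suc)

∈-catMaybes-tabulate : ∀ {n} {A : Set} (h : Fin n → Maybe A) z {a} → h z ≡ just a → a ∈ catMaybes (tabulate h)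
∈-catMaybes-tabulate h zero hz rewrite hz = here refl
∈-catMaybes-tabulate h (suc z) hz with h zero
... | just _  = there (∈-catMaybes-tabulate (h ∘ suc) z hz)
... | nothing = ∈-catMaybes-tabulate (h ∘ suc) z hz

-- A list of fewer than c colours misses some colour (pigeonhole on the positions of the colours).
unused-element : ∀ {c} (xs : List (Fin c)) → length xs < c → ∃ λ i → i ∉ xs
unused-element {c} xs lt = FP.¬∀⟶∃¬ c (_∈ xs) (λ i → any? (i F.≟_) xs) all∈⇒⊥
  where
  all∈⇒⊥ : (∀ i → i ∈ xs) → ⊥
  all∈⇒⊥ all∈ with FP.pigeonhole lt (λ i → index (all∈ i))
  ... | i , j , i<j , same = <-irrefl (cong F.toℕ i≡j) i<j
    where
    i≡j : i ≡ j
    i≡j = trans (lookup-index (all∈ i)) (trans (cong (lookup xs) same) (≡-sym (lookup-index (all∈ j))))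

edge-sym : ∀ {n} (G : Graph n) {a b} → Edge G a b → Edge G b a
edge-sym G {a} {b} e = trans (sym G b a) e

edge-≢ : ∀ {n} (G : Graph n) {a b} → Edge G a b → a ≢ b
edge-≢ G {a} e refl with () ← trans (≡-sym (irrefl G a)) e

module EdgeColouring {n} (G : Graph n) (c : ℕ) where

  deg : Fin n → ℕ
  deg x = count (adj G x)

  SameEdge : (x y a b : Fin n) → Set
  SameEdge x y a b = (a ≡ x × b ≡ y) ⊎ (a ≡ y × b ≡ x)

  sameEdge? : ∀ x y a b → Dec (SameEdge x y a b)
  sameEdge? x y a b = ((a F.≟ x) ×-dec (b F.≟ y)) ⊎-dec ((a F.≟ y) ×-dec (b F.≟ x))

  sameEdge-flip : ∀ {x y a b} → SameEdge x y a b → SameEdge x y b a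
  sameEdge-flip (inj₁ (p , q)) = inj₂ (q , p)
  sameEdge-flip (inj₂ (p , q)) = inj₁ (q , p)

  setEdge : Labeling G c → Fin n → Fin n → Fin c → Labeling G c
  setEdge L x y i = record { lab = newLab ; labSym = newLab-sym }
    where
    newLab : Fin n → Fin n → Label c
    newLab a b with sameEdge? x y a b
    ... | yes _ = just i
    ... | no _  = lab L a b
    newLab-sym : ∀ a b → Edge G a b → newLab a b ≡ newLab b a
    newLab-sym a b e with sameEdge? x y a b | sameEdge? x y b a
    ... | yes _ | yes _ = refl
    ... | no _  | no _  = labSym L a b e
    ... | yes s | no ¬s = ⊥-elim (¬s (sameEdge-flip s))
    ... | no ¬s | yes s = ⊥-elim (¬s (sameEdge-flip s))

  setEdge-cases : ∀ L x y i a b →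
    (SameEdge x y a b × lab (setEdge L x y i) a b ≡ just i) ⊎ (¬ SameEdge x y a b × lab (setEdge L x y i) a b ≡ lab L a b)
  setEdge-cases L x y i a b with sameEdge? x y a b
  ... | yes s = inj₁ (s , refl)
  ... | no ¬s = inj₂ (¬s , refl)

  Free : Labeling G c → Fin n → Fin n → Fin c → Set
  Free L x y i = ∀ z → Edge G x z → z ≢ y → lab L x z ≡ just i → Edge G y z

  -- Only paths through the recoloured edge are new, and freeness at both ends closes them.
  setEdge-STC : ∀ L x y i → IsSTC L → Edge G x y → Free L x y i → Free L y x i → IsSTC (setEdge L x y i)
  setEdge-STC L x y i stc exy free-x free-y a b d j a≢d eab ebd lab₁ lab₂
    with sameEdge? x y a b | sameEdge? x y b d
  ... | yes (inj₁ (refl , refl)) | yes (inj₁ (refl , refl)) = ⊥-elim (edge-≢ G exy refl)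
  ... | yes (inj₁ (refl , refl)) | yes (inj₂ (refl , refl)) = ⊥-elim (a≢d refl)
  ... | yes (inj₂ (refl , refl)) | yes (inj₁ (refl , refl)) = ⊥-elim (a≢d refl)
  ... | yes (inj₂ (refl , refl)) | yes (inj₂ (refl , refl)) = ⊥-elim (edge-≢ G exy refl)
  ... | yes (inj₁ (refl , refl)) | no _ = free-y d ebd (a≢d ∘ ≡-sym) (trans lab₂ (≡-sym lab₁))
  ... | yes (inj₂ (refl , refl)) | no _ = free-x d ebd (a≢d ∘ ≡-sym) (trans lab₂ (≡-sym lab₁))
  ... | no _ | yes (inj₁ (refl , refl)) =
    edge-sym G (free-x a (edge-sym G eab) a≢d (trans (≡-sym (labSym L a b eab)) (trans lab₁ (≡-sym lab₂))))
  ... | no _ | yes (inj₂ (refl , refl)) =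
    edge-sym G (free-y a (edge-sym G eab) a≢d (trans (≡-sym (labSym L a b eab)) (trans lab₁ (≡-sym lab₂))))
  ... | no _ | no _ = stc a b d j a≢d eab ebd lab₁ lab₂

  clash : Labeling G c → Fin n → Fin n → Fin n → Label c
  clash L x y z = if adj G x z ∧ (not ⌊ z F.≟ y ⌋ ∧ not (adj G y z)) then lab L x z else nothing

  clashing : Labeling G c → Fin n → Fin n → List (Fin c)
  clashing L x y = catMaybes (tabulate (clash L x y))

  clash-value : ∀ L x y z → Edge G x z → z ≢ y → adj G y z ≡ false → clash L x y z ≡ lab L x z
  clash-value L x y z exz z≢y ayz with z F.≟ y
  ... | yes z≡y = ⊥-elim (z≢y z≡y)
  ... | no _ rewrite exz | ayz = refl

  -- A colour outside both clashing lists is free at both ends.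
  free-colour : ∀ L x y → length (clashing L x y ++ clashing L y x) < c → ∃ λ i → Free L x y i × Free L y x i
  free-colour L x y short with unused-element (clashing L x y ++ clashing L y x) short
  ... | i , i∉ = i , free-x , free-y
    where
    free-x : Free L x y i
    free-x z exz z≢y lxz with adj G y z in ayz
    ... | true  = refl
    ... | false = ⊥-elim (i∉ (∈-++⁺ˡ (∈-catMaybes-tabulate (clash L x y) z (trans (clash-value L x y z exz z≢y ayz) lxz))))
    free-y : Free L y x i
    free-y z eyz z≢x lyz with adj G x z in axz
    ... | true  = refl
    ... | false = ⊥-elim (i∉ (∈-++⁺ʳ (clashing L x y)
                   (∈-catMaybes-tabulate (clash L y x) z (trans (clash-value L y x z eyz z≢x axz) lyz))))

  clash⇒edge : ∀ L x y → (is-just ∘ clash L x y) ⇒ᵇ adj G x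
  clash⇒edge L x y z e with adj G x z
  ... | true  = refl
  ... | false with () ← e

  NoClash : Labeling G c → Fin n → Fin n → Fin n → Set
  NoClash L x y z = z ≡ y ⊎ Edge G y z ⊎ lab L x z ≡ nothing

  no-clash : ∀ L x y z → NoClash L x y z → is-just (clash L x y z) ≡ false
  no-clash L x y z (inj₁ refl) with adj G x z | z F.≟ z
  ... | false | _ = refl
  ... | true | yes _ = refl
  ... | true | no z≢z = ⊥-elim (z≢z refl)
  no-clash L x y z (inj₂ (inj₁ eyz)) rewrite eyz with adj G x z | z F.≟ y
  ... | false | _ = refl
  ... | true | yes _ = refl
  ... | true | no _ = refl
  no-clash L x y z (inj₂ (inj₂ weak)) with adj G x z ∧ (not ⌊ z F.≟ y ⌋ ∧ not (adj G y z))
  ... | false = refl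
  ... | true rewrite weak = refl

  clashCount : Labeling G c → Fin n → Fin n → ℕ
  clashCount L x y = count (is-just ∘ clash L x y)

  -- y itself never clashes, so x has fewer clashes than neighbours.
  clashCount<deg : ∀ L x y → Edge G x y → suc (clashCount L x y) ≤ deg x
  clashCount<deg L x y exy = count-mono-strict _ (adj G x) (clash⇒edge L x y) y (no-clash L x y y (inj₁ refl)) exy

  Room : Labeling G c → Fin n → Fin n → Set
  Room L x y = ∃ λ z → z ≢ y × Edge G x z × (Edge G y z ⊎ lab L x z ≡ nothing)

  clashCount+1<deg : ∀ L x y → Edge G x y → Room L x y → suc (suc (clashCount L x y)) ≤ deg x
  clashCount+1<deg L x y exy (z , z≢y , exz , safe) =
    count-mono-strict₂ _ (adj G x) (clash⇒edge L x y) y z (z≢y ∘ ≡-sym)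
      (no-clash L x y y (inj₁ refl)) exy (no-clash L x y z (inj₂ safe)) exz

  few-clashes : ∀ L x y → Edge G x y → deg x ≤ suc (c / 2) → deg y ≤ suc (c / 2) → Room L x y →
    suc (clashCount L x y + clashCount L y x) ≤ c
  few-clashes L x y exy dx dy room = begin
    suc (clashCount L x y) + clashCount L y x ≤⟨ +-mono-≤ (≤-pred (≤-trans (clashCount+1<deg L x y exy room) dx))
                                                          (≤-pred (≤-trans (clashCount<deg L y x (edge-sym G exy)) dy)) ⟩
    c / 2 + c / 2                             ≤⟨ half ⟩
    c                                         ∎
    where
    open ≤-Reasoning
    half : c / 2 + c / 2 ≤ c
    half = begin
      c / 2 + c / 2       ≡⟨ cong (c / 2 +_) (≡-sym (+-identityʳ (c / 2))) ⟩
      c / 2 + (c / 2 + 0) ≡⟨ *-comm 2 (c / 2) ⟩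
      c / 2 * 2           ≤⟨ m/n*n≤m c 2 ⟩
      c                   ∎

  Colourable : Labeling G c → Fin n → Fin n → Set
  Colourable L x y = Room L x y ⊎ Room L y x

  colourEdge : ∀ L x y → IsSTC L → Edge G x y → deg x ≤ suc (c / 2) → deg y ≤ suc (c / 2) →
    Colourable L x y → ∃ λ i → IsSTC (setEdge L x y i)
  colourEdge L x y stc exy dx dy col with free-colour L x y short
    where
    bound : Colourable L x y → suc (clashCount L x y + clashCount L y x) ≤ c
    bound (inj₁ room) = few-clashes L x y exy dx dy room
    bound (inj₂ room) = subst (λ k → suc k ≤ c) (+-comm (clashCount L y x) _)
                        (few-clashes L y x (edge-sym G exy) dy dx room)
    short : length (clashing L x y ++ clashing L y x) < c
    short = subst (λ k → suc k ≤ c)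
      (≡-sym (trans (length-++ (clashing L x y))
                    (cong₂ _+_ (length-catMaybes-tabulate (clash L x y)) (length-catMaybes-tabulate (clash L y x)))))
      (bound col)
  ... | i , free-x , free-y = i , setEdge-STC L x y i stc exy free-x free-y

-- In the periphery no edge is deleted, so the degree bound on (V, E ∖ D) holds in G itself.
periphery-degree : ∀ {n c} (G : Graph n) (Δ : DeletionSet G c) x → InPeriphery Δ x →
  count (adj G x) ≤ suc (c / 2)
periphery-degree {n} {c} G Δ x x∉core = subst (_≤ suc (c / 2)) degMinus≡deg (degree Δ x)
  where
  kept≡adj : ∀ z → (adj G x z ∧ not (D Δ x z)) ≡ adj G x z
  kept≡adj z with D Δ x z in dxz
  ... | true  = ⊥-elim (x∉core (z , dxz))
  ... | false = ∧-identityʳ _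
  degMinus≡deg : degMinus G (D Δ) x ≡ count (adj G x)
  degMinus≡deg = trans (length-filter-tabulate (λ z → adj G x z ∧ not (D Δ x z)) (λ z → z)) (count-cong _ _ kept≡adj)

-- The least k ≤ m with p k, or m if there is none; used to define breadth-first depth.
least : ℕ → (ℕ → Bool) → ℕ
least zero p = 0
least (suc m) p = if p 0 then 0 else suc (least m (p ∘ suc))

least≤ : ∀ m (p : ℕ → Bool) j → p j ≡ true → least m p ≤ j
least≤ zero p j pj = z≤n
least≤ (suc m) p j pj with p 0 in p0
... | true = z≤n
least≤ (suc m) p zero pj | false with () ← trans (≡-sym p0) pj
least≤ (suc m) p (suc j) pj | false = s≤s (least≤ m (p ∘ suc) j pj)

least-holds : ∀ m (p : ℕ → Bool) j → p j ≡ true → j ≤ m → p (least m p) ≡ true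
least-holds zero p zero pj _ = pj
least-holds (suc m) p j pj j≤m with p 0 in p0
... | true = p0
least-holds (suc m) p zero pj j≤m | false with () ← trans (≡-sym p0) pj
least-holds (suc m) p (suc j) pj (s≤s j≤m) | false = least-holds m (p ∘ suc) j pj j≤m

least-minimal : ∀ m (p : ℕ → Bool) k → k < least m p → p k ≡ false
least-minimal (suc m) p k k< with p 0 in p0
least-minimal (suc m) p zero k< | false = p0
least-minimal (suc m) p (suc k) (s≤s k<) | false = least-minimal m (p ∘ suc) k k<

least≤bound : ∀ m (p : ℕ → Bool) → least m p ≤ m
least≤bound zero p = z≤n
least≤bound (suc m) p with p 0
... | true  = z≤n
... | false = s≤s (least≤bound m (p ∘ suc))

total : ∀ {n} → (Fin n → ℕ) → ℕ
total {zero} f = 0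
total {suc n} f = f zero + total (f ∘ suc)

term≤total : ∀ {n} (f : Fin n → ℕ) z → f z ≤ total f
term≤total f zero = m≤m+n _ _
term≤total f (suc z) = ≤-trans (term≤total (f ∘ suc) z) (m≤n+m _ _)

ClosedIn : ∀ {n} → Graph n → (Fin n → Bool) → (Fin n → Set) → Set
ClosedIn {n} G A Q = ∀ {y z : Fin n} → Q y → A z ≡ true → Edge G y z → Q z

reach-end : ∀ {n} {G : Graph n} {S : Fin n → Set} {x y} → ReachIn G S x y → S y
reach-end (here s) = s
reach-end (step _ s _) = s

-- If A is the set of vertices reachable from x₀, a closed predicate holding somewhere in A
-- holds on all of A: it spreads back along a path to x₀ and then forward to every vertex.
closed-on-component : ∀ {n} (G : Graph n) (S : Fin n → Set) (A : Fin n → Bool) x₀ →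
  (∀ y → (A y ≡ true) ⇔ ReachIn G S x₀ y) → (Q : Fin n → Set) → ClosedIn G A Q →
  ∀ a → A a ≡ true → Q a → ∀ y → A y ≡ true → Q y
closed-on-component G S A x₀ comp Q closed a Aa Qa y Ay =
  forward (Equivalence.to (comp y) Ay) (backward (Equivalence.to (comp a) Aa) Qa)
  where
  onPath : ∀ {z} → ReachIn G S x₀ z → A z ≡ true
  onPath {z} = Equivalence.from (comp z)
  backward : ∀ {z} → ReachIn G S x₀ z → Q z → Q x₀
  backward (here _) q = q
  backward (step p _ e) q = backward p (closed q (onPath p) (edge-sym G e))
  forward : ∀ {z} → ReachIn G S x₀ z → Q x₀ → Q z
  forward (here _) q = q
  forward (step p s e) q = closed (forward p q) (onPath (step p s e)) e

someᵇ : ∀ {n} → (Fin n → Bool) → Bool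
someᵇ {zero} f = false
someᵇ {suc n} f = f zero ∨ someᵇ (f ∘ suc)

someᵇ-intro : ∀ {n} (f : Fin n → Bool) z → f z ≡ true → someᵇ f ≡ true
someᵇ-intro f zero fz rewrite fz = refl
someᵇ-intro f (suc z) fz with f zero
... | true  = refl
... | false = someᵇ-intro (f ∘ suc) z fz

someᵇ-elim : ∀ {n} (f : Fin n → Bool) → someᵇ f ≡ true → ∃ λ z → f z ≡ true
someᵇ-elim {suc n} f some with f zero in f0
... | true  = zero , f0
... | false with someᵇ-elim (f ∘ suc) some
... | z , fz = suc z , fz

∧-true : ∀ a b → a ∧ b ≡ true → a ≡ true × b ≡ true
∧-true true true _ = refl , refl

∨-true : ∀ a b → a ∨ b ≡ true → a ≡ true ⊎ b ≡ true
∨-true true  b _ = inj₁ refl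
∨-true false b e = inj₂ e

just≢nothing : ∀ {X : Set} {x : X} → just x ≢ nothing
just≢nothing ()

module Layers {n} (G : Graph n) (A : Fin n → Bool) (isRoot : Fin n → Bool) (roots⊆A : isRoot ⇒ᵇ A) where

  layer : ℕ → Fin n → Bool
  layer zero y = isRoot y
  layer (suc k) y = layer k y ∨ (A y ∧ someᵇ (λ z → layer k z ∧ adj G z y))

  layer⊆A : ∀ k → layer k ⇒ᵇ A
  layer⊆A zero = roots⊆A
  layer⊆A (suc k) y in-layer with ∨-true (layer k y) _ in-layer
  ... | inj₁ earlier = layer⊆A k y earlier
  ... | inj₂ added   = proj₁ (∧-true (A y) _ added)

  Reached : Fin n → Set
  Reached y = ∃ λ k → layer k y ≡ true

  reached-closed : ClosedIn G A Reached
  reached-closed {y} {z} (k , ly) Az eyz = suc k , grows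
    where
    grows : layer (suc k) z ≡ true
    grows with layer k z
    ... | true  = refl
    ... | false rewrite Az = someᵇ-intro (λ z' → layer k z' ∧ adj G z' z) y
                               (subst (λ b → b ∧ adj G y z ≡ true) (≡-sym ly) eyz)

  module Depth (reached : ∀ y → A y ≡ true → Reached y) where

    -- A layer containing y, for each y in A; their total bounds all depths.
    witness : Fin n → ℕ
    witness y with A y B.≟ true
    ... | yes Ay = proj₁ (reached y Ay)
    ... | no _   = 0

    witness-layer : ∀ y → A y ≡ true → layer (witness y) y ≡ true
    witness-layer y Ay with A y B.≟ true
    ... | yes Ay′ = proj₂ (reached y Ay′)
    ... | no ¬Ay  = ⊥-elim (¬Ay Ay)

    bound : ℕ
    bound = total witness

    depth : Fin n → ℕ
    depth y = least bound (λ k → layer k y)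

    depth≤bound : ∀ y → depth y ≤ bound
    depth≤bound y = least≤bound bound _

    depth-root : ∀ y → isRoot y ≡ true → depth y ≡ 0
    depth-root y root = n≤0⇒n≡0 (least≤ bound (λ k → layer k y) 0 root)

    layer-depth : ∀ y → A y ≡ true → layer (depth y) y ≡ true
    layer-depth y Ay = least-holds bound (λ k → layer k y) (witness y) (witness-layer y Ay) (term≤total witness y)

    above-depth : ∀ y k → k < depth y → layer k y ≡ false
    above-depth y = least-minimal bound (λ k → layer k y)

    parent : ∀ x → A x ≡ true → isRoot x ≡ false → ∃ λ p → A p ≡ true × Edge G x p × depth p < depth x
    parent x Ax notRoot with depth x in depth≡ | layer-depth x Ax
    ... | zero  | in-layer with () ← trans (≡-sym notRoot) in-layer
    ... | suc k | in-layer with ∨-true (layer k x) _ in-layer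
    ...   | inj₁ earlier with () ← trans (≡-sym (above-depth x k (≤-reflexive (≡-sym depth≡)))) earlier
    ...   | inj₂ added with someᵇ-elim _ (proj₂ (∧-true (A x) _ added))
    ...     | p , found with ∧-true (layer k p) _ found
    ...       | p-layer , epx = p , layer⊆A k p p-layer , edge-sym G epx ,
                                s≤s (least≤ bound (λ j → layer j p) k p-layer)

module TriangleComponent {n} (G : Graph n) (c : ℕ) (Δ : DeletionSet G c) (A : Fin n → Bool)
  (x₀ : Fin n) (component : ∀ y → (A y ≡ true) ⇔ ReachIn G (InPeriphery Δ) x₀ y)
  (u v w : Fin n) (uv∈EA : InEA G A u v) (vw : Edge G v w) (uw : Edge G u w) where

  open EdgeColouring G c

  uv : Edge G u v
  uv = proj₁ uv∈EA

  isRoot : Fin n → Bool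
  isRoot y = ⌊ y F.≟ u ⌋ ∨ ⌊ y F.≟ v ⌋

  root-cases : ∀ y → isRoot y ≡ true → y ≡ u ⊎ y ≡ v
  root-cases y root with y F.≟ u | y F.≟ v
  ... | yes y≡u | _       = inj₁ y≡u
  ... | no _    | yes y≡v = inj₂ y≡v

  root-intro : ∀ y → y ≡ u ⊎ y ≡ v → isRoot y ≡ true
  root-intro y (inj₁ refl) with y F.≟ y
  ... | yes _   = refl
  ... | no y≢y = ⊥-elim (y≢y refl)
  root-intro y (inj₂ refl) with y F.≟ u | y F.≟ y
  ... | yes _ | _      = refl
  ... | no _  | yes _  = refl
  ... | no _  | no y≢y = ⊥-elim (y≢y refl)

  u-root : isRoot u ≡ true
  u-root = root-intro u (inj₁ refl)

  root-edge : ∀ {x y} → x ≡ u ⊎ x ≡ v → y ≡ u ⊎ y ≡ v → Edge G x y → SameEdge u v x y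
  root-edge (inj₁ refl) (inj₁ refl) xy = ⊥-elim (edge-≢ G xy refl)
  root-edge (inj₁ refl) (inj₂ refl) xy = inj₁ (refl , refl)
  root-edge (inj₂ refl) (inj₁ refl) xy = inj₂ (refl , refl)
  root-edge (inj₂ refl) (inj₂ refl) xy = ⊥-elim (edge-≢ G xy refl)

  roots⊆A : isRoot ⇒ᵇ A
  roots⊆A y root with root-cases y root
  ... | inj₁ refl = proj₁ (proj₂ uv∈EA)
  ... | inj₂ refl = proj₂ (proj₂ uv∈EA)

  open Layers G A isRoot roots⊆A

  -- A is connected, so the layers around {u,v} exhaust it.
  all-reached : ∀ y → A y ≡ true → Reached y
  all-reached = closed-on-component G (InPeriphery Δ) A x₀ component Reached reached-closed
                  u (roots⊆A u u-root) (0 , u-root)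

  open Depth all-reached

  -- Vertices of A are peripheral, hence of degree at most ⌊c/2⌋+1.
  A-degree : ∀ y → A y ≡ true → deg y ≤ suc (c / 2)
  A-degree y Ay = periphery-degree G Δ y (reach-end (Equivalence.to (component y) Ay))

  key : Fin n → Fin n → ℕ
  key a b = depth a + depth b

  key≤ : ∀ a b → key a b ≤ bound + bound
  key≤ a b = +-mono-≤ (depth≤bound a) (depth≤bound b)

  key-sameEdge : ∀ {a b p q} → SameEdge a b p q → key p q ≡ key a b
  key-sameEdge (inj₁ (refl , refl)) = refl
  key-sameEdge {a} {b} (inj₂ (refl , refl)) = +-comm (depth b) (depth a)

  LowerAt : Fin n → Fin n → Set
  LowerAt x y = ∃ λ p → p ≢ y × Edge G x p × A p ≡ true × key x p < key x y

  depth-pos : ∀ y → A y ≡ true → isRoot y ≡ false → 0 < depth y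
  depth-pos y Ay notRoot with parent y Ay notRoot
  ... | _ , _ , _ , below = ≤-trans (s≤s z≤n) below

  partner : ∀ x → x ≡ u ⊎ x ≡ v → ∃ λ r → isRoot r ≡ true × Edge G x r × A r ≡ true
  partner x (inj₁ refl) = v , root-intro v (inj₂ refl) , uv , proj₂ (proj₂ uv∈EA)
  partner x (inj₂ refl) = u , u-root , edge-sym G uv , proj₁ (proj₂ uv∈EA)

  -- At its shallower end x, an edge {x,y} of E(A) other than {u,v} has a lower edge:
  -- the parent edge of x, or {u,v} itself when x is a root.
  shallow-end : ∀ x y → InEA G A x y → depth x ≤ depth y → SameEdge u v x y ⊎ LowerAt x y
  shallow-end x y (xy , Ax , Ay) dx≤dy with isRoot x in x-root
  ... | false with parent x Ax x-root
  ...   | q , Aq , xq , dq<dx = inj₂ (q , q≢y , xq , Aq , +-monoʳ-< (depth x) (<-≤-trans dq<dx dx≤dy))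
    where
    q≢y : q ≢ y
    q≢y refl = <-irrefl refl (<-≤-trans dq<dx dx≤dy)
  shallow-end x y (xy , Ax , Ay) dx≤dy | true with isRoot y in y-root
  ... | true = inj₁ (root-edge (root-cases x x-root) (root-cases y y-root) xy)
  ... | false with partner x (root-cases x x-root)
  ...   | r , r-root , xr , Ar = inj₂ (r , r≢y , xr , Ar , lower)
    where
    r≢y : r ≢ y
    r≢y refl with () ← trans (≡-sym y-root) r-root
    lower : depth x + depth r < depth x + depth y
    lower rewrite depth-root x x-root | depth-root r r-root = depth-pos y Ay y-root

  InEA-flip : ∀ {x y} → InEA G A x y → InEA G A y x
  InEA-flip (xy , Ax , Ay) = edge-sym G xy , Ay , Ax

  InEA-sameEdge : ∀ {a b p q} → InEA G A a b → SameEdge a b p q → InEA G A p q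
  InEA-sameEdge ab (inj₁ (refl , refl)) = ab
  InEA-sameEdge ab (inj₂ (refl , refl)) = InEA-flip ab

  lower-edge : ∀ x y → InEA G A x y → SameEdge u v x y ⊎ LowerAt x y ⊎ LowerAt y x
  lower-edge x y xy∈ with ≤-total (depth x) (depth y)
  ... | inj₁ dx≤dy with shallow-end x y xy∈ dx≤dy
  ...   | inj₁ root  = inj₁ root
  ...   | inj₂ lower = inj₂ (inj₁ lower)
  lower-edge x y xy∈ | inj₂ dy≤dx with shallow-end y x (InEA-flip xy∈) dy≤dx
  ...   | inj₁ root  = inj₁ (sameEdge-flip root)
  ...   | inj₂ lower = inj₂ (inj₂ lower)

  WeakBelow : ℕ → Labeling G c → Set
  WeakBelow t L = ∀ a b → InEA G A a b → key a b < t → lab L a b ≡ nothing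

  -- While the edges below key t are still weak, every edge of key t can be coloured:
  -- {u,v} through the triangle, any other edge through its (weak) lower edge.
  colourable : ∀ t L → WeakBelow t L → ∀ x y → InEA G A x y → key x y ≡ t → Colourable L x y
  colourable t L weak x y xy∈ key≡t with lower-edge x y xy∈
  ... | inj₁ (inj₁ (refl , refl)) = inj₁ (w , edge-≢ G vw ∘ ≡-sym , uw , inj₁ vw)
  ... | inj₁ (inj₂ (refl , refl)) = inj₂ (w , edge-≢ G vw ∘ ≡-sym , uw , inj₁ vw)
  ... | inj₂ (inj₁ (p , p≢y , xp , Ap , lower)) =
    inj₁ (p , p≢y , xp , inj₂ (weak x p (xp , proj₁ (proj₂ xy∈) , Ap) (subst (key x p <_) key≡t lower)))
  ... | inj₂ (inj₂ (p , p≢x , yp , Ap , lower)) =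
    inj₂ (p , p≢x , yp , inj₂ (weak y p (yp , proj₂ (proj₂ xy∈) , Ap)
                                 (subst (key y p <_) (trans (+-comm (depth y) (depth x)) key≡t) lower)))

  module FromLabeling (L₀ : Labeling G c) where

    StrongAt : ℕ → Fin n × Fin n → Labeling G c → Set
    StrongAt t (a , b) L = InEA G A a b → key a b ≡ t → lab L a b ≢ nothing

    record Progress (t : ℕ) (L : Labeling G c) : Set where
      field
        stc          : IsSTC L
        outside      : PartiallyEqualOutside A L₀ L
        weak-below   : WeakBelow t L
        strong-above : ∀ a b → InEA G A a b → t < key a b → lab L a b ≢ nothing
    open Progress

    StaysStrong : Labeling G c → Labeling G c → Set
    StaysStrong L L′ = ∀ a b → lab L a b ≢ nothing → lab L′ a b ≢ nothing

    colourOne : ∀ t L → Progress t L → ∀ a b → InEA G A a b → key a b ≡ t →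
      Σ (Labeling G c) λ L′ → Progress t L′ × StrongAt t (a , b) L′ × StaysStrong L L′
    colourOne t L P a b ab∈ key≡t
      with colourEdge L a b (stc P) (proj₁ ab∈) (A-degree a (proj₁ (proj₂ ab∈))) (A-degree b (proj₂ (proj₂ ab∈)))
                      (colourable t L (weak-below P) a b ab∈ key≡t)
    ... | i , stc′ = L′ , progress , (λ _ _ → strong-ab) , stays
      where
      L′ : Labeling G c
      L′ = setEdge L a b i
      strong-ab : lab L′ a b ≢ nothing
      strong-ab with setEdge-cases L a b i a b
      ... | inj₁ (_ , coloured) = just≢nothing ∘ trans (≡-sym coloured)
      ... | inj₂ (¬same , _)    = ⊥-elim (¬same (inj₁ (refl , refl)))
      progress : Progress t L′
      progress .stc = stc′
      progress .outside p q pq p∉ with setEdge-cases L a b i p q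
      ... | inj₁ (same , _)   = ⊥-elim (p∉ (InEA-sameEdge ab∈ same))
      ... | inj₂ (_ , kept)   = trans (outside P p q pq p∉) (≡-sym kept)
      progress .weak-below p q pq∈ below with setEdge-cases L a b i p q
      ... | inj₁ (same , _)   = ⊥-elim (<-irrefl (trans (key-sameEdge same) key≡t) below)
      ... | inj₂ (_ , kept)   = trans kept (weak-below P p q pq∈ below)
      progress .strong-above p q pq∈ above with setEdge-cases L a b i p q
      ... | inj₁ (_ , coloured) = just≢nothing ∘ trans (≡-sym coloured)
      ... | inj₂ (_ , kept)     = strong-above P p q pq∈ above ∘ trans (≡-sym kept)
      stays : StaysStrong L L′
      stays p q strong with setEdge-cases L a b i p q
      ... | inj₁ (_ , coloured) = just≢nothing ∘ trans (≡-sym coloured)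
      ... | inj₂ (_ , kept)     = strong ∘ trans (≡-sym kept)

    inEA? : ∀ a b → Dec (InEA G A a b)
    inEA? a b = (adj G a b B.≟ true) ×-dec ((A a B.≟ true) ×-dec (A b B.≟ true))

    colourPair : ∀ t q L → Progress t L → Σ (Labeling G c) λ L′ → Progress t L′ × StrongAt t q L′ × StaysStrong L L′
    colourPair t (a , b) L P with inEA? a b | key a b ≟ t
    ... | yes ab∈ | yes key≡t = colourOne t L P a b ab∈ key≡t
    ... | yes _   | no key≢t  = L , P , (λ _ key≡t → ⊥-elim (key≢t key≡t)) , (λ _ _ strong → strong)
    ... | no ab∉  | _         = L , P , (λ ab∈ _ → ⊥-elim (ab∉ ab∈)) , (λ _ _ strong → strong)

    colourList : ∀ t (qs : List (Fin n × Fin n)) L → Progress t L →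
      Σ (Labeling G c) λ L′ → Progress t L′ × (∀ q → q ∈ qs → StrongAt t q L′) × StaysStrong L L′
    colourList t [] L P = L , P , (λ _ ()) , (λ _ _ strong → strong)
    colourList t (q ∷ qs) L P with colourPair t q L P
    ... | L₁ , P₁ , strong-q , stays₁ with colourList t qs L₁ P₁
    ...   | L₂ , P₂ , strong-qs , stays₂ = L₂ , P₂ , strong , (λ a b → stays₂ a b ∘ stays₁ a b)
      where
      strong : ∀ q′ → q′ ∈ q ∷ qs → StrongAt t q′ L₂
      strong (a , b) (here refl) ab∈ key≡t = stays₂ a b (strong-q ab∈ key≡t)
      strong q′ (there q′∈qs) = strong-qs q′ q′∈qs

    allPairs : List (Fin n × Fin n)
    allPairs = cartesianProduct (allFin n) (allFin n)

    phase : ∀ t L → Progress t L →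
      Σ (Labeling G c) λ L′ → Progress t L′ × (∀ a b → InEA G A a b → t ≤ key a b → lab L′ a b ≢ nothing)
    phase t L P with colourList t allPairs L P
    ... | L′ , P′ , strong-t , _ = L′ , P′ , strong
      where
      strong : ∀ a b → InEA G A a b → t ≤ key a b → lab L′ a b ≢ nothing
      strong a b ab∈ t≤key with m≤n⇒m<n∨m≡n t≤key
      ... | inj₁ above = strong-above P′ a b ab∈ above
      ... | inj₂ t≡key = strong-t (a , b) (∈-cartesianProduct⁺ (∈-allFin a) (∈-allFin b)) ab∈ (≡-sym t≡key)

    descend : ∀ t L → Progress t L →
      Σ (Labeling G c) λ L′ → IsSTC L′ × PartiallyEqualOutside A L₀ L′ × (∀ a b → InEA G A a b → lab L′ a b ≢ nothing)
    descend zero L P with phase 0 L P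
    ... | L′ , P′ , strong = L′ , stc P′ , outside P′ , λ a b ab∈ → strong a b ab∈ z≤n
    descend (suc t) L P with phase (suc t) L P
    ... | L′ , P′ , strong = descend t L′ next
      where
      next : Progress t L′
      next .stc = stc P′
      next .outside = outside P′
      next .weak-below a b ab∈ below = weak-below P′ a b ab∈ (m<n⇒m<1+n below)
      next .strong-above = strong

    -- At the start every key lies below suc (bound + bound), so all of E(A) counts as "below".
    start : IsSTC L₀ → WeakBelow (suc (bound + bound)) L₀ → Progress (suc (bound + bound)) L₀
    start stc₀ weak₀ .stc = stc₀
    start stc₀ weak₀ .outside _ _ _ _ = refl
    start stc₀ weak₀ .weak-below = weak₀
    start stc₀ weak₀ .strong-above a b _ above = ⊥-elim (≤⇒≯ (key≤ a b) (<-trans (n<1+n _) above))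

    colour-all : IsSTC L₀ → (∀ a b → InEA G A a b → lab L₀ a b ≡ nothing) →
      Σ (Labeling G c) λ L′ → IsSTC L′ × PartiallyEqualOutside A L₀ L′ × (∀ a b → InEA G A a b → lab L′ a b ≢ nothing)
    colour-all stc₀ weak₀ = descend (suc (bound + bound)) L₀ (start stc₀ (λ a b ab∈ _ → weak₀ a b ab∈))

proposition25 : ∀ {n} (G : Graph n) (c k : ℕ) (Δ : DeletionSet G c) (A : Fin n → Bool) →
    IsPeripheryComponent Δ A →
    (∃[ u ] ∃[ v ] ∃[ w ] (InEA G A u v × Edge G v w × Edge G u w)) →
    IsGood G c A
proposition25 G c k Δ A (x₀ , _ , component) (u , v , w , uv∈EA , vw , uw) L₀ stc₀ weak₀ =
  TriangleComponent.FromLabeling.colour-all G c Δ A x₀ component u v w uv∈EA vw uw L₀ stc₀ weak₀
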